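{- In $\mathbf{IPF}^\iota$, for every formula $F$, variables $x\neq y$, and formula $G(z)$ with a free variable $z$: $\exists y(\forall x(F\leftrightarrow x=y)\land G(y))\vdash G(\iota xF)$.
   Context: $G(t)$ denotes the result of substituting the term $t$ for $z$ in $G(z)$ (with $y$ assumed not to occur in $F$ or $G$ otherwise). $\mathbf{IPF}$ is a natural deduction system of intuitionist positive free logic: a first-order language without function symbols, primitive predicate $\exists!$ ("exists"), identity; standard intuitionist rules for $\land,\rightarrow,\lor,\leftrightarrow$, $\bot E$ to atomic conclusions; $\forall I$ (infer $\forall xA$ from a deduction of $A^x_a$, discharging $\exists!a$, $a$ fresh), $\forall E$ (from $\forall xA$ and $\exists!t$ infer $A^x_t$), $\exists I$ (from $A^x_t$ and $\exists!t$ infer $\exists xA$), $\exists E$ (from $\exists xA$ and a deduction of $C$ from $A^x_a,\exists!a$ infer $C$, discharging them, $a$ fresh); $=I$: axiom $t=t$; $=E$: from $t_1=t_2$ and $A^x_{t_1}$ infer $A^x_{t_2}$ ($A$ atomic; derivable for arbitrary $A$). $\mathbf{IPF}^\iota$ extends $\mathbf{IPF}$ by description terms $\iota xF$ ("the $F$", binding $x$), terms $t$ ranging also over these, and the axiom (Lambert's Law) $\forall y(\iota xF=y\leftrightarrow\forall x(F\leftrightarrow x=y))$ for distinct $x,y$. -}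

module Defs where

-- Syntax and natural-deduction system of IPF^ι (intuitionist positive free
-- logic with definite descriptions), in intrinsically scoped de Bruijn form.
-- A term/formula of type  Term n / Formula n  has n free variables
-- (variable 0 = the most recently bound one).  Binders (∀, ∃, ι) bind
-- variable 0.  Capture-avoiding substitution is built in.

open import Data.Nat using (ℕ; zero; suc)
open import Data.Fin using (Fin; zero; suc)
open import Data.Vec using (Vec; []; _∷_)
open import Data.List using (List; []; _∷_; map)
open import Data.List.Membership.Propositional using (_∈_)

infixr 6 _∧'_
infixr 5 _∨'_
infixr 4 _⇒_ _⇔_
infix 7 _≐_

mutual
  data Term (n : ℕ) : Set where
    var : Fin n → Term n
    ι   : Formula (suc n) → Term n

  data Formula (n : ℕ) : Set where
    pred : (p : ℕ) (k : ℕ) → Vec (Term n) k → Formula n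
    E!   : Term n → Formula n
    _≐_  : Term n → Term n → Formula n
    ⊥'   : Formula n
    _∧'_ _∨'_ _⇒_ _⇔_ : Formula n → Formula n → Formula n
    ∀' ∃' : Formula (suc n) → Formula n

-- Atomic formulas (⊥E and =E are restricted to these)
data Atomic {n : ℕ} : Formula n → Set where
  at-pred : ∀ p k ts → Atomic (pred p k ts)
  at-E!   : ∀ t → Atomic (E! t)
  at-≐    : ∀ s t → Atomic (s ≐ t)
  at-⊥    : Atomic ⊥'

Ren : ℕ → ℕ → Set
Ren n m = Fin n → Fin m

liftR : ∀ {n m} → Ren n m → Ren (suc n) (suc m)
liftR ρ zero    = zero
liftR ρ (suc i) = suc (ρ i)

mutual
  renT : ∀ {n m} → Ren n m → Term n → Term m
  renT ρ (var i) = var (ρ i)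
  renT ρ (ι F)   = ι (renF (liftR ρ) F)

  renTs : ∀ {n m k} → Ren n m → Vec (Term n) k → Vec (Term m) k
  renTs ρ []       = []
  renTs ρ (t ∷ ts) = renT ρ t ∷ renTs ρ ts

  renF : ∀ {n m} → Ren n m → Formula n → Formula m
  renF ρ (pred p k ts) = pred p k (renTs ρ ts)
  renF ρ (E! t)  = E! (renT ρ t)
  renF ρ (s ≐ t) = renT ρ s ≐ renT ρ t
  renF ρ ⊥'      = ⊥'
  renF ρ (A ∧' B) = renF ρ A ∧' renF ρ B
  renF ρ (A ∨' B) = renF ρ A ∨' renF ρ B
  renF ρ (A ⇒ B)  = renF ρ A ⇒ renF ρ B
  renF ρ (A ⇔ B)  = renF ρ A ⇔ renF ρ B
  renF ρ (∀' A)   = ∀' (renF (liftR ρ) A)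
  renF ρ (∃' A)   = ∃' (renF (liftR ρ) A)

wkF : ∀ {n} → Formula n → Formula (suc n)
wkF = renF suc

Sub : ℕ → ℕ → Set
Sub n m = Fin n → Term m

liftS : ∀ {n m} → Sub n m → Sub (suc n) (suc m)
liftS σ zero    = var zero
liftS σ (suc i) = renT suc (σ i)

mutual
  subT : ∀ {n m} → Sub n m → Term n → Term m
  subT σ (var i) = σ i
  subT σ (ι F)   = ι (subF (liftS σ) F)

  subTs : ∀ {n m k} → Sub n m → Vec (Term n) k → Vec (Term m) k
  subTs σ []       = []
  subTs σ (t ∷ ts) = subT σ t ∷ subTs σ ts

  subF : ∀ {n m} → Sub n m → Formula n → Formula m
  subF σ (pred p k ts) = pred p k (subTs σ ts)
  subF σ (E! t)  = E! (subT σ t)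
  subF σ (s ≐ t) = subT σ s ≐ subT σ t
  subF σ ⊥'      = ⊥'
  subF σ (A ∧' B) = subF σ A ∧' subF σ B
  subF σ (A ∨' B) = subF σ A ∨' subF σ B
  subF σ (A ⇒ B)  = subF σ A ⇒ subF σ B
  subF σ (A ⇔ B)  = subF σ A ⇔ subF σ B
  subF σ (∀' A)   = ∀' (subF (liftS σ) A)
  subF σ (∃' A)   = ∃' (subF (liftS σ) A)

sub0 : ∀ {n} → Term n → Sub (suc n) n
sub0 t zero    = t
sub0 t (suc i) = var i

_[_] : ∀ {n} → Formula (suc n) → Term n → Formula n
A [ t ] = subF (sub0 t) A

-- Lambert's Law instance for F (x = variable 0 of F):
--   ∀y (ι x F = y ↔ ∀x (F ↔ x = y))
-- Under the binders, y is variable 1 (inside ∀x) resp. variable 0, and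
-- F is shifted past y:  F↑ = renF (liftR suc) F  (x stays 0, y is 1).
F↑ : ∀ {n} → Formula (suc n) → Formula (suc (suc n))
F↑ F = renF (liftR suc) F

Lambert : ∀ {n} → Formula (suc n) → Formula n
Lambert F = ∀' ((ι (F↑ F) ≐ var zero) ⇔ ∀' (F↑ F ⇔ (var zero ≐ var (suc zero))))

Ctx : ℕ → Set
Ctx n = List (Formula n)

wkC : ∀ {n} → Ctx n → Ctx (suc n)
wkC = map wkF

infix 2 _⊢_

data _⊢_ {n : ℕ} (Γ : Ctx n) : Formula n → Set where
  hyp  : ∀ {A} → A ∈ Γ → Γ ⊢ A
  ∧I   : ∀ {A B} → Γ ⊢ A → Γ ⊢ B → Γ ⊢ A ∧' B
  ∧E₁  : ∀ {A B} → Γ ⊢ A ∧' B → Γ ⊢ A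
  ∧E₂  : ∀ {A B} → Γ ⊢ A ∧' B → Γ ⊢ B
  ⇒I   : ∀ {A B} → A ∷ Γ ⊢ B → Γ ⊢ A ⇒ B
  ⇒E   : ∀ {A B} → Γ ⊢ A ⇒ B → Γ ⊢ A → Γ ⊢ B
  ∨I₁  : ∀ {A B} → Γ ⊢ A → Γ ⊢ A ∨' B
  ∨I₂  : ∀ {A B} → Γ ⊢ B → Γ ⊢ A ∨' B
  ∨E   : ∀ {A B C} → Γ ⊢ A ∨' B → A ∷ Γ ⊢ C → B ∷ Γ ⊢ C → Γ ⊢ C
  ⇔I   : ∀ {A B} → A ∷ Γ ⊢ B → B ∷ Γ ⊢ A → Γ ⊢ A ⇔ B
  ⇔E₁  : ∀ {A B} → Γ ⊢ A ⇔ B → Γ ⊢ A → Γ ⊢ B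
  ⇔E₂  : ∀ {A B} → Γ ⊢ A ⇔ B → Γ ⊢ B → Γ ⊢ A
  ⊥E   : ∀ {A} → Atomic A → Γ ⊢ ⊥' → Γ ⊢ A
  -- ∀I: from A^x_a with a fresh (new variable 0) and assumption ∃!a discharged
  ∀I   : ∀ {A} → E! (var zero) ∷ wkC Γ ⊢ A → Γ ⊢ ∀' A
  ∀E   : ∀ {A} (t : Term n) → Γ ⊢ ∀' A → Γ ⊢ E! t → Γ ⊢ A [ t ]
  ∃I   : ∀ {A} (t : Term n) → Γ ⊢ A [ t ] → Γ ⊢ E! t → Γ ⊢ ∃' A
  -- ∃E: C derivable from A^x_a, ∃!a (a fresh), discharging them
  ∃E   : ∀ {A C} → Γ ⊢ ∃' A → A ∷ E! (var zero) ∷ wkC Γ ⊢ wkF C → Γ ⊢ C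
  =I   : ∀ t → Γ ⊢ t ≐ t
  =E   : ∀ {A} {t₁ t₂ : Term n} → Atomic A → Γ ⊢ t₁ ≐ t₂ → Γ ⊢ A [ t₁ ] → Γ ⊢ A [ t₂ ]
  lambert : ∀ F → Γ ⊢ Lambert F

{-# OPTIONS --safe #-}
module Submission where

-- Open the premise by ∃E: a witness y with ∃!y, ∀x(F ↔ x = y) and G(y).
-- Lambert's Law instantiated at y turns the uniqueness clause into ιxF = y,
-- and replacement of equals, extended from atomic formulas to arbitrary
-- ones by induction on the formula, carries G(y) over to G(ιxF).

open import Defs
open import Data.Nat using (suc)
open import Data.Fin using (zero; suc)
open import Data.List using ([]; _∷_; map)
open import Data.List.Properties using (map-∘; map-cong)
open import Data.List.Relation.Unary.Any using (here; there)
open import Data.List.Membership.Propositional.Properties using (∈-map⁺)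
open import Data.List.Relation.Binary.Subset.Propositional using (_⊆_)
open import Data.List.Relation.Binary.Subset.Propositional.Properties
  using (map⁺; ∷⁺ʳ)
open import Data.Vec using (Vec; []; _∷_)
open import Relation.Binary.PropositionalEquality
  using (_≡_; refl; sym; trans; cong; cong₂; subst; subst₂)

mutual
  renT-renT : ∀ {a b c} {ρ₁ : Ren a b} {ρ₂ : Ren b c} {ρ₃ : Ren a c} →
              (∀ i → ρ₂ (ρ₁ i) ≡ ρ₃ i) → ∀ t → renT ρ₂ (renT ρ₁ t) ≡ renT ρ₃ t
  renT-renT h (var i) = cong var (h i)
  renT-renT h (ι F)   = cong ι (renF-renF (liftR-liftR h) F)

  renTs-renTs : ∀ {a b c k} {ρ₁ : Ren a b} {ρ₂ : Ren b c} {ρ₃ : Ren a c} →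
                (∀ i → ρ₂ (ρ₁ i) ≡ ρ₃ i) → (ts : Vec (Term a) k) →
                renTs ρ₂ (renTs ρ₁ ts) ≡ renTs ρ₃ ts
  renTs-renTs h []       = refl
  renTs-renTs h (t ∷ ts) = cong₂ _∷_ (renT-renT h t) (renTs-renTs h ts)

  renF-renF : ∀ {a b c} {ρ₁ : Ren a b} {ρ₂ : Ren b c} {ρ₃ : Ren a c} →
              (∀ i → ρ₂ (ρ₁ i) ≡ ρ₃ i) → ∀ A → renF ρ₂ (renF ρ₁ A) ≡ renF ρ₃ A
  renF-renF h (pred p k ts) = cong (pred p k) (renTs-renTs h ts)
  renF-renF h (E! t)   = cong E! (renT-renT h t)
  renF-renF h (s ≐ t)  = cong₂ _≐_ (renT-renT h s) (renT-renT h t)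
  renF-renF h ⊥'       = refl
  renF-renF h (A ∧' B) = cong₂ _∧'_ (renF-renF h A) (renF-renF h B)
  renF-renF h (A ∨' B) = cong₂ _∨'_ (renF-renF h A) (renF-renF h B)
  renF-renF h (A ⇒ B)  = cong₂ _⇒_ (renF-renF h A) (renF-renF h B)
  renF-renF h (A ⇔ B)  = cong₂ _⇔_ (renF-renF h A) (renF-renF h B)
  renF-renF h (∀' A)   = cong ∀' (renF-renF (liftR-liftR h) A)
  renF-renF h (∃' A)   = cong ∃' (renF-renF (liftR-liftR h) A)

  liftR-liftR : ∀ {a b c} {ρ₁ : Ren a b} {ρ₂ : Ren b c} {ρ₃ : Ren a c} →
                (∀ i → ρ₂ (ρ₁ i) ≡ ρ₃ i) → ∀ i → liftR ρ₂ (liftR ρ₁ i) ≡ liftR ρ₃ i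
  liftR-liftR h zero    = refl
  liftR-liftR h (suc i) = cong suc (h i)

mutual
  subT-renT : ∀ {a b c} {ρ : Ren a b} {σ : Sub b c} {τ : Sub a c} →
              (∀ i → σ (ρ i) ≡ τ i) → ∀ t → subT σ (renT ρ t) ≡ subT τ t
  subT-renT h (var i) = h i
  subT-renT h (ι F)   = cong ι (subF-renF (liftS-liftR h) F)

  subTs-renTs : ∀ {a b c k} {ρ : Ren a b} {σ : Sub b c} {τ : Sub a c} →
                (∀ i → σ (ρ i) ≡ τ i) → (ts : Vec (Term a) k) →
                subTs σ (renTs ρ ts) ≡ subTs τ ts
  subTs-renTs h []       = refl
  subTs-renTs h (t ∷ ts) = cong₂ _∷_ (subT-renT h t) (subTs-renTs h ts)

  subF-renF : ∀ {a b c} {ρ : Ren a b} {σ : Sub b c} {τ : Sub a c} →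
              (∀ i → σ (ρ i) ≡ τ i) → ∀ A → subF σ (renF ρ A) ≡ subF τ A
  subF-renF h (pred p k ts) = cong (pred p k) (subTs-renTs h ts)
  subF-renF h (E! t)   = cong E! (subT-renT h t)
  subF-renF h (s ≐ t)  = cong₂ _≐_ (subT-renT h s) (subT-renT h t)
  subF-renF h ⊥'       = refl
  subF-renF h (A ∧' B) = cong₂ _∧'_ (subF-renF h A) (subF-renF h B)
  subF-renF h (A ∨' B) = cong₂ _∨'_ (subF-renF h A) (subF-renF h B)
  subF-renF h (A ⇒ B)  = cong₂ _⇒_ (subF-renF h A) (subF-renF h B)
  subF-renF h (A ⇔ B)  = cong₂ _⇔_ (subF-renF h A) (subF-renF h B)
  subF-renF h (∀' A)   = cong ∀' (subF-renF (liftS-liftR h) A)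
  subF-renF h (∃' A)   = cong ∃' (subF-renF (liftS-liftR h) A)

  liftS-liftR : ∀ {a b c} {ρ : Ren a b} {σ : Sub b c} {τ : Sub a c} →
                (∀ i → σ (ρ i) ≡ τ i) → ∀ i → liftS σ (liftR ρ i) ≡ liftS τ i
  liftS-liftR h zero    = refl
  liftS-liftR h (suc i) = cong (renT suc) (h i)

mutual
  renT-subT : ∀ {a b c} {σ : Sub a b} {ρ : Ren b c} {τ : Sub a c} →
              (∀ i → renT ρ (σ i) ≡ τ i) → ∀ t → renT ρ (subT σ t) ≡ subT τ t
  renT-subT h (var i) = h i
  renT-subT h (ι F)   = cong ι (renF-subF (liftR-liftS h) F)

  renTs-subTs : ∀ {a b c k} {σ : Sub a b} {ρ : Ren b c} {τ : Sub a c} →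
                (∀ i → renT ρ (σ i) ≡ τ i) → (ts : Vec (Term a) k) →
                renTs ρ (subTs σ ts) ≡ subTs τ ts
  renTs-subTs h []       = refl
  renTs-subTs h (t ∷ ts) = cong₂ _∷_ (renT-subT h t) (renTs-subTs h ts)

  renF-subF : ∀ {a b c} {σ : Sub a b} {ρ : Ren b c} {τ : Sub a c} →
              (∀ i → renT ρ (σ i) ≡ τ i) → ∀ A → renF ρ (subF σ A) ≡ subF τ A
  renF-subF h (pred p k ts) = cong (pred p k) (renTs-subTs h ts)
  renF-subF h (E! t)   = cong E! (renT-subT h t)
  renF-subF h (s ≐ t)  = cong₂ _≐_ (renT-subT h s) (renT-subT h t)
  renF-subF h ⊥'       = refl
  renF-subF h (A ∧' B) = cong₂ _∧'_ (renF-subF h A) (renF-subF h B)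
  renF-subF h (A ∨' B) = cong₂ _∨'_ (renF-subF h A) (renF-subF h B)
  renF-subF h (A ⇒ B)  = cong₂ _⇒_ (renF-subF h A) (renF-subF h B)
  renF-subF h (A ⇔ B)  = cong₂ _⇔_ (renF-subF h A) (renF-subF h B)
  renF-subF h (∀' A)   = cong ∀' (renF-subF (liftR-liftS h) A)
  renF-subF h (∃' A)   = cong ∃' (renF-subF (liftR-liftS h) A)

  liftR-liftS : ∀ {a b c} {σ : Sub a b} {ρ : Ren b c} {τ : Sub a c} →
                (∀ i → renT ρ (σ i) ≡ τ i) → ∀ i → renT (liftR ρ) (liftS σ i) ≡ liftS τ i
  liftR-liftS h zero = refl
  liftR-liftS {σ = σ} h (suc i) =
    trans (renT-renT (λ _ → refl) (σ i))
      (trans (sym (renT-renT (λ _ → refl) (σ i))) (cong (renT suc) (h i)))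

mutual
  subT-id : ∀ {a} {σ : Sub a a} → (∀ i → σ i ≡ var i) → ∀ t → subT σ t ≡ t
  subT-id h (var i) = h i
  subT-id h (ι F)   = cong ι (subF-id (liftS-id h) F)

  subTs-id : ∀ {a k} {σ : Sub a a} → (∀ i → σ i ≡ var i) →
             (ts : Vec (Term a) k) → subTs σ ts ≡ ts
  subTs-id h []       = refl
  subTs-id h (t ∷ ts) = cong₂ _∷_ (subT-id h t) (subTs-id h ts)

  subF-id : ∀ {a} {σ : Sub a a} → (∀ i → σ i ≡ var i) → ∀ A → subF σ A ≡ A
  subF-id h (pred p k ts) = cong (pred p k) (subTs-id h ts)
  subF-id h (E! t)   = cong E! (subT-id h t)
  subF-id h (s ≐ t)  = cong₂ _≐_ (subT-id h s) (subT-id h t)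
  subF-id h ⊥'       = refl
  subF-id h (A ∧' B) = cong₂ _∧'_ (subF-id h A) (subF-id h B)
  subF-id h (A ∨' B) = cong₂ _∨'_ (subF-id h A) (subF-id h B)
  subF-id h (A ⇒ B)  = cong₂ _⇒_ (subF-id h A) (subF-id h B)
  subF-id h (A ⇔ B)  = cong₂ _⇔_ (subF-id h A) (subF-id h B)
  subF-id h (∀' A)   = cong ∀' (subF-id (liftS-id h) A)
  subF-id h (∃' A)   = cong ∃' (subF-id (liftS-id h) A)

  liftS-id : ∀ {a} {σ : Sub a a} → (∀ i → σ i ≡ var i) → ∀ i → liftS σ i ≡ var i
  liftS-id h zero    = refl
  liftS-id h (suc i) = cong (renT suc) (h i)

subT-sub0-renT-suc : ∀ {n} (s t : Term n) → subT (sub0 s) (renT suc t) ≡ t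
subT-sub0-renT-suc s t = trans (subT-renT (λ _ → refl) t) (subT-id (λ _ → refl) t)

renF-[] : ∀ {n m} (ρ : Ren n m) (A : Formula (suc n)) t →
          renF ρ (A [ t ]) ≡ renF (liftR ρ) A [ renT ρ t ]
renF-[] ρ A t = trans (renF-subF (λ _ → refl) A) (sym (subF-renF sub0-liftR A))
  where
  sub0-liftR : ∀ i → sub0 (renT ρ t) (liftR ρ i) ≡ renT ρ (sub0 t i)
  sub0-liftR zero    = refl
  sub0-liftR (suc i) = refl

renF-liftR-suc-[var₀] : ∀ {n} (A : Formula (suc n)) → renF (liftR suc) A [ var zero ] ≡ A
renF-liftR-suc-[var₀] A = trans (subF-renF collapse A) (subF-id (λ _ → refl) A)
  where
  collapse : ∀ i → sub0 (var zero) (liftR suc i) ≡ var i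
  collapse zero    = refl
  collapse (suc i) = refl

subF-liftS-sub0-F↑ : ∀ {n} (t : Term n) (F : Formula (suc n)) →
                     subF (liftS (sub0 t)) (F↑ F) ≡ F
subF-liftS-sub0-F↑ t F = trans (subF-renF collapse F) (subF-id (λ _ → refl) F)
  where
  collapse : ∀ i → liftS (sub0 t) (liftR suc i) ≡ var i
  collapse zero    = refl
  collapse (suc i) = refl

renF-wkF : ∀ {n m} (ρ : Ren n m) (C : Formula n) → renF (liftR ρ) (wkF C) ≡ wkF (renF ρ C)
renF-wkF ρ C = trans (renF-renF (λ _ → refl) C) (sym (renF-renF (λ _ → refl) C))

map-renF-wkC : ∀ {n m} (ρ : Ren n m) (Γ : Ctx n) →
               map (renF (liftR ρ)) (wkC Γ) ≡ wkC (map (renF ρ) Γ)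
map-renF-wkC ρ Γ = trans (sym (map-∘ Γ)) (trans (map-cong (renF-wkF ρ) Γ) (map-∘ Γ))

renF-Lambert : ∀ {n m} (ρ : Ren n m) (F : Formula (suc n)) →
               renF ρ (Lambert F) ≡ Lambert (renF (liftR ρ) F)
renF-Lambert ρ F =
  cong (λ X → ∀' ((ι X ≐ var zero) ⇔ ∀' (X ⇔ (var zero ≐ var (suc zero))))) renF-F↑
  where
  liftR-commute : ∀ i → liftR suc (liftR ρ i) ≡ liftR (liftR ρ) (liftR suc i)
  liftR-commute zero    = refl
  liftR-commute (suc i) = refl

  renF-F↑ : renF (liftR (liftR ρ)) (F↑ F) ≡ F↑ (renF (liftR ρ) F)
  renF-F↑ = trans (renF-renF (λ _ → refl) F) (sym (renF-renF liftR-commute F))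

Atomic-renF : ∀ {n m} (ρ : Ren n m) {A} → Atomic A → Atomic (renF ρ A)
Atomic-renF ρ (at-pred p k ts) = at-pred _ _ _
Atomic-renF ρ (at-E! t)        = at-E! _
Atomic-renF ρ (at-≐ s t)       = at-≐ _ _
Atomic-renF ρ at-⊥             = at-⊥

⊢-mono : ∀ {n} {Γ Δ : Ctx n} {A} → Γ ⊆ Δ → Γ ⊢ A → Δ ⊢ A
⊢-mono s (hyp x)     = hyp (s x)
⊢-mono s (∧I d e)    = ∧I (⊢-mono s d) (⊢-mono s e)
⊢-mono s (∧E₁ d)     = ∧E₁ (⊢-mono s d)
⊢-mono s (∧E₂ d)     = ∧E₂ (⊢-mono s d)
⊢-mono s (⇒I d)      = ⇒I (⊢-mono (∷⁺ʳ _ s) d)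
⊢-mono s (⇒E d e)    = ⇒E (⊢-mono s d) (⊢-mono s e)
⊢-mono s (∨I₁ d)     = ∨I₁ (⊢-mono s d)
⊢-mono s (∨I₂ d)     = ∨I₂ (⊢-mono s d)
⊢-mono s (∨E d e f)  = ∨E (⊢-mono s d) (⊢-mono (∷⁺ʳ _ s) e) (⊢-mono (∷⁺ʳ _ s) f)
⊢-mono s (⇔I d e)    = ⇔I (⊢-mono (∷⁺ʳ _ s) d) (⊢-mono (∷⁺ʳ _ s) e)
⊢-mono s (⇔E₁ d e)   = ⇔E₁ (⊢-mono s d) (⊢-mono s e)
⊢-mono s (⇔E₂ d e)   = ⇔E₂ (⊢-mono s d) (⊢-mono s e)
⊢-mono s (⊥E a d)    = ⊥E a (⊢-mono s d)
⊢-mono s (∀I d)      = ∀I (⊢-mono (∷⁺ʳ _ (map⁺ wkF s)) d)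
⊢-mono s (∀E t d e)  = ∀E t (⊢-mono s d) (⊢-mono s e)
⊢-mono s (∃I t d e)  = ∃I t (⊢-mono s d) (⊢-mono s e)
⊢-mono s (∃E d e)    = ∃E (⊢-mono s d) (⊢-mono (∷⁺ʳ _ (∷⁺ʳ _ (map⁺ wkF s))) e)
⊢-mono s (=I t)      = =I t
⊢-mono s (=E a d e)  = =E a (⊢-mono s d) (⊢-mono s e)
⊢-mono s (lambert F) = lambert F

⊢-renF : ∀ {n m} (ρ : Ren n m) {Γ : Ctx n} {A} → Γ ⊢ A → map (renF ρ) Γ ⊢ renF ρ A
⊢-renF ρ (hyp x)    = hyp (∈-map⁺ (renF ρ) x)
⊢-renF ρ (∧I d e)   = ∧I (⊢-renF ρ d) (⊢-renF ρ e)
⊢-renF ρ (∧E₁ d)    = ∧E₁ (⊢-renF ρ d)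
⊢-renF ρ (∧E₂ d)    = ∧E₂ (⊢-renF ρ d)
⊢-renF ρ (⇒I d)     = ⇒I (⊢-renF ρ d)
⊢-renF ρ (⇒E d e)   = ⇒E (⊢-renF ρ d) (⊢-renF ρ e)
⊢-renF ρ (∨I₁ d)    = ∨I₁ (⊢-renF ρ d)
⊢-renF ρ (∨I₂ d)    = ∨I₂ (⊢-renF ρ d)
⊢-renF ρ (∨E d e f) = ∨E (⊢-renF ρ d) (⊢-renF ρ e) (⊢-renF ρ f)
⊢-renF ρ (⇔I d e)   = ⇔I (⊢-renF ρ d) (⊢-renF ρ e)
⊢-renF ρ (⇔E₁ d e)  = ⇔E₁ (⊢-renF ρ d) (⊢-renF ρ e)
⊢-renF ρ (⇔E₂ d e)  = ⇔E₂ (⊢-renF ρ d) (⊢-renF ρ e)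
⊢-renF ρ (⊥E a d)   = ⊥E (Atomic-renF ρ a) (⊢-renF ρ d)
⊢-renF ρ {Γ} (∀I d) =
  ∀I (subst (λ Δ → E! (var zero) ∷ Δ ⊢ _) (map-renF-wkC ρ Γ) (⊢-renF (liftR ρ) d))
⊢-renF ρ (∀E {A} t d e) =
  subst (_ ⊢_) (sym (renF-[] ρ A t)) (∀E (renT ρ t) (⊢-renF ρ d) (⊢-renF ρ e))
⊢-renF ρ (∃I {A} t d e) =
  ∃I (renT ρ t) (subst (_ ⊢_) (renF-[] ρ A t) (⊢-renF ρ d)) (⊢-renF ρ e)
⊢-renF ρ {Γ} (∃E {A} {C} d e) =
  ∃E (⊢-renF ρ d)
    (subst₂ (λ Δ X → renF (liftR ρ) A ∷ E! (var zero) ∷ Δ ⊢ X)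
      (map-renF-wkC ρ Γ) (renF-wkF ρ C) (⊢-renF (liftR ρ) e))
⊢-renF ρ (=I t) = =I _
⊢-renF ρ (=E {A} {t₁} {t₂} a d e) =
  subst (_ ⊢_) (sym (renF-[] ρ A t₂))
    (=E (Atomic-renF (liftR ρ) a) (⊢-renF ρ d) (subst (_ ⊢_) (renF-[] ρ A t₁) (⊢-renF ρ e)))
⊢-renF ρ {Γ} (lambert F) = subst (map (renF ρ) Γ ⊢_) (sym (renF-Lambert ρ F)) (lambert _)

⊢-weaken : ∀ {n} {Γ : Ctx n} {C D} → Γ ⊢ C → D ∷ Γ ⊢ C
⊢-weaken = ⊢-mono there

⊢-wkF : ∀ {n} {Γ : Ctx n} {C} → Γ ⊢ C → E! (var zero) ∷ wkC Γ ⊢ wkF C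
⊢-wkF d = ⊢-weaken (⊢-renF suc d)

≐-sym : ∀ {n} {Γ : Ctx n} {t₁ t₂} → Γ ⊢ t₁ ≐ t₂ → Γ ⊢ t₂ ≐ t₁
≐-sym {t₁ = t₁} {t₂} e =
  subst (λ u → _ ⊢ t₂ ≐ u) (subT-sub0-renT-suc t₂ t₁)
    (=E {A = var zero ≐ renT suc t₁} (at-≐ _ _) e
      (subst (λ u → _ ⊢ t₁ ≐ u) (sym (subT-sub0-renT-suc t₁ t₁)) (=I t₁)))

swap01 : ∀ {n} → Ren (suc (suc n)) (suc (suc n))
swap01 zero          = suc zero
swap01 (suc zero)    = zero
swap01 (suc (suc i)) = suc (suc i)

liftS-sub0-swap01 : ∀ {k m} (ρ : Ren k (suc m)) (B : Formula (suc k)) (t : Term m) →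
  subF (liftS (sub0 t)) (renF (liftR ρ) B)
    ≡ renF (λ i → swap01 (liftR ρ i)) B [ renT suc t ]
liftS-sub0-swap01 ρ B t = trans (subF-renF (λ _ → refl) B) (sym (subF-renF agree B))
  where
  agree : ∀ i → sub0 (renT suc t) (swap01 (liftR ρ i)) ≡ liftS (sub0 t) (liftR ρ i)
  agree zero = refl
  agree (suc i) with ρ i
  ... | zero  = refl
  ... | suc j = refl

-- Quantifying over the renaming ρ is what makes the
-- induction go through: under a binder the replaced variable becomes variable 1,
-- and composing ρ with swap01 moves it back to position 0.
=E-renF : ∀ {k m} {Γ : Ctx m} (A : Formula k) (ρ : Ren k (suc m)) {t₁ t₂} →
          Γ ⊢ t₁ ≐ t₂ → Γ ⊢ renF ρ A [ t₁ ] → Γ ⊢ renF ρ A [ t₂ ]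
=E-renF (pred p k ts) ρ e d = =E {A = renF ρ (pred p k ts)} (at-pred _ _ _) e d
=E-renF (E! t)        ρ e d = =E {A = renF ρ (E! t)} (at-E! _) e d
=E-renF (s ≐ t)       ρ e d = =E {A = renF ρ (s ≐ t)} (at-≐ _ _) e d
=E-renF ⊥'            ρ e d = d
=E-renF (A ∧' B) ρ e d = ∧I (=E-renF A ρ e (∧E₁ d)) (=E-renF B ρ e (∧E₂ d))
=E-renF (A ∨' B) ρ e d =
  ∨E d (∨I₁ (=E-renF A ρ (⊢-weaken e) (hyp (here refl))))
       (∨I₂ (=E-renF B ρ (⊢-weaken e) (hyp (here refl))))
=E-renF (A ⇒ B) ρ e d =
  ⇒I (=E-renF B ρ (⊢-weaken e)
       (⇒E (⊢-weaken d) (=E-renF A ρ (⊢-weaken (≐-sym e)) (hyp (here refl)))))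
=E-renF (A ⇔ B) ρ e d =
  ⇔I (=E-renF B ρ (⊢-weaken e)
       (⇔E₁ (⊢-weaken d) (=E-renF A ρ (⊢-weaken (≐-sym e)) (hyp (here refl)))))
     (=E-renF A ρ (⊢-weaken e)
       (⇔E₂ (⊢-weaken d) (=E-renF B ρ (⊢-weaken (≐-sym e)) (hyp (here refl)))))
=E-renF (∀' B) ρ {t₁} {t₂} e d =
  ∀I (subst (_ ⊢_) (sym (liftS-sub0-swap01 ρ B t₂))
       (=E-renF B (λ i → swap01 (liftR ρ i)) (⊢-wkF e)
         (subst (_ ⊢_) (trans (renF-liftR-suc-[var₀] _) (liftS-sub0-swap01 ρ B t₁))
           (∀E (var zero) (⊢-wkF d) (hyp (here refl))))))
=E-renF {Γ = Γ} (∃' B) ρ {t₁} {t₂} e d =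
  ∃E d (∃I (var zero)
         (subst (Δ ⊢_) (sym (trans (renF-liftR-suc-[var₀] _) (liftS-sub0-swap01 ρ B t₂)))
           (=E-renF B (λ i → swap01 (liftR ρ i)) (⊢-weaken (⊢-wkF e))
             (subst (Δ ⊢_) (liftS-sub0-swap01 ρ B t₁) (hyp (here refl)))))
         (hyp (there (here refl))))
  where
  Δ : Ctx (suc _)
  Δ = subF (liftS (sub0 t₁)) (renF (liftR ρ) B) ∷ E! (var zero) ∷ wkC Γ

lambert-at : ∀ {n} {Γ : Ctx n} (F : Formula (suc n)) {t} →
             Γ ⊢ E! t → Γ ⊢ (ι F ≐ t) ⇔ ∀' (F ⇔ (var zero ≐ renT suc t))
lambert-at F {t} e =
  subst (λ X → _ ⊢ (ι X ≐ t) ⇔ ∀' (X ⇔ (var zero ≐ renT suc t)))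
    (subF-liftS-sub0-F↑ t F) (∀E t (lambert F) e)

mainTheorem7 : ∀ {n} (F G : Formula (suc n)) →
    (∃' (∀' (F↑ F ⇔ (var zero ≐ var (suc zero))) ∧' G) ∷ []) ⊢ G [ ι F ]
mainTheorem7 {n} F G = ∃E (hyp (here refl)) G[ιF]
  where
  unique : Formula (suc n)
  unique = ∀' (F↑ F ⇔ (var zero ≐ var (suc zero)))

  Δ : Ctx (suc n)
  Δ = (unique ∧' G) ∷ E! (var zero) ∷ wkC (∃' (unique ∧' G) ∷ [])

  y≐ιF : Δ ⊢ var zero ≐ ι (F↑ F)
  y≐ιF = ≐-sym (⇔E₂ (lambert-at (F↑ F) (hyp (there (here refl)))) (∧E₁ (hyp (here refl))))

  G[y] : Δ ⊢ renF (liftR suc) G [ var zero ]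
  G[y] = subst (Δ ⊢_) (sym (renF-liftR-suc-[var₀] G)) (∧E₂ (hyp (here refl)))

  G[ιF] : Δ ⊢ wkF (G [ ι F ])
  G[ιF] = subst (Δ ⊢_) (sym (renF-[] suc G (ι F))) (=E-renF G (liftR suc) y≐ιF G[y])
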